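{- The class $\mathsf{CID}_{\div,\bot}$ of integral domains with common division is not a quasivariety, i.e. there is no set of conditional equations over $\Sigma$ whose models are exactly the algebras in $\mathsf{CID}_{\div,\bot}$.
   Context: $\Sigma$ is the signature with constants $0,1,\bot$, unary $-$, binary $+,\cdot,\div$. For an integral domain $R$, $\mathsf{Enl}_\bot(R_\div)$ is the $\Sigma$-algebra with carrier $R\cup\{\bot\}$, $\bot\notin R$, ring operations on $R$, every operation returning $\bot$ when an argument is $\bot$, and for $a,b\in R$: $a\div b=a\cdot c$ if some $c\in R$ has $b\cdot c=1$, and $a\div b=\bot$ otherwise. $\mathsf{CID}_{\div,\bot}$ is the class of all algebras isomorphic to such $\mathsf{Enl}_\bot(R_\div)$ with $R$ an integral domain. A conditional equation is a universally quantified formula $t_1=r_1\wedge\dots\wedge t_n=r_n\to t=r$ with terms over $\Sigma$. -}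

module Defs where

open import Data.Nat using (ℕ)
open import Data.Maybe using (Maybe; just; nothing)
open import Data.Product using (Σ; ∃; _×_; _,_)
open import Data.Sum using (_⊎_)
open import Data.List using (List)
open import Data.List.Relation.Unary.All using (All)
open import Relation.Nullary using (¬_)
open import Relation.Binary.PropositionalEquality using (_≡_)
open import Algebra.Structures using (IsCommutativeRing)
open import Function.Definitions using (Bijective)
open import Function.Bundles using (_⇔_)

record Alg : Set₁ where
  field
    Carrier : Set
    zero one bot : Carrier
    neg : Carrier → Carrier
    add mul div : Carrier → Carrier → Carrier

data Term : Set where
  var : ℕ → Term
  `0 `1 `⊥ : Term
  `- : Term → Term
  _`+_ _`·_ _`÷_ : Term → Term → Term

⟦_⟧ : Term → (A : Alg) → (ℕ → Alg.Carrier A) → Alg.Carrier A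
⟦ var x ⟧ A ρ = ρ x
⟦ `0 ⟧ A ρ = Alg.zero A
⟦ `1 ⟧ A ρ = Alg.one A
⟦ `⊥ ⟧ A ρ = Alg.bot A
⟦ `- t ⟧ A ρ = Alg.neg A (⟦ t ⟧ A ρ)
⟦ t `+ u ⟧ A ρ = Alg.add A (⟦ t ⟧ A ρ) (⟦ u ⟧ A ρ)
⟦ t `· u ⟧ A ρ = Alg.mul A (⟦ t ⟧ A ρ) (⟦ u ⟧ A ρ)
⟦ t `÷ u ⟧ A ρ = Alg.div A (⟦ t ⟧ A ρ) (⟦ u ⟧ A ρ)

Eqn : Set
Eqn = Term × Term

HoldsAt : (A : Alg) → (ℕ → Alg.Carrier A) → Eqn → Set
HoldsAt A ρ (t , r) = ⟦ t ⟧ A ρ ≡ ⟦ r ⟧ A ρ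

record CondEq : Set where
  constructor _⇒_
  field
    premises : List Eqn
    conclusion : Eqn

_⊨_ : Alg → CondEq → Set
A ⊨ (ps ⇒ c) = (ρ : ℕ → Alg.Carrier A) → All (HoldsAt A ρ) ps → HoldsAt A ρ c

record IntegralDomain : Set₁ where
  field
    Carrier : Set
    _+_ _*_ : Carrier → Carrier → Carrier
    -_ : Carrier → Carrier
    0# 1# : Carrier
    isCommutativeRing : IsCommutativeRing _≡_ _+_ _*_ -_ 0# 1#
    1≢0 : ¬ (1# ≡ 0#)
    noZeroDivisors : ∀ a b → a * b ≡ 0# → (a ≡ 0#) ⊎ (b ≡ 0#)

-- A is isomorphic to Enl_⊥(R_÷), where the carrier R ∪ {⊥} is
-- represented by Maybe R (nothing = ⊥).  Since common division is not
-- computable constructively, Enl_⊥(R_÷) is described through the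
-- isomorphism h : Maybe R → A directly: h is a bijection that maps the
-- operations of Enl_⊥(R_÷) to those of A.

module _ (R : IntegralDomain) where
  open IntegralDomain R

  lift₁ : (Carrier → Carrier) → Maybe Carrier → Maybe Carrier
  lift₁ f (just a) = just (f a)
  lift₁ f nothing = nothing

  lift₂ : (Carrier → Carrier → Carrier) → Maybe Carrier → Maybe Carrier → Maybe Carrier
  lift₂ f (just a) (just b) = just (f a b)
  lift₂ f _ _ = nothing

  record IsEnlIso (A : Alg) (h : Maybe Carrier → Alg.Carrier A) : Set where
    field
      bijective : Bijective _≡_ _≡_ h
      hom-0 : h (just 0#) ≡ Alg.zero A
      hom-1 : h (just 1#) ≡ Alg.one A
      hom-⊥ : h nothing ≡ Alg.bot A
      hom-neg : ∀ x → h (lift₁ -_ x) ≡ Alg.neg A (h x)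
      hom-add : ∀ x y → h (lift₂ _+_ x y) ≡ Alg.add A (h x) (h y)
      hom-mul : ∀ x y → h (lift₂ _*_ x y) ≡ Alg.mul A (h x) (h y)
      hom-div-⊥ˡ : ∀ y → h nothing ≡ Alg.div A (h nothing) (h y)
      hom-div-⊥ʳ : ∀ x → h nothing ≡ Alg.div A (h x) (h nothing)
      hom-div-inv : ∀ a b c → b * c ≡ 1# →
        h (just (a * c)) ≡ Alg.div A (h (just a)) (h (just b))
      hom-div-noninv : ∀ a b → ¬ (∃ λ c → b * c ≡ 1#) →
        h nothing ≡ Alg.div A (h (just a)) (h (just b))

InCID : Alg → Set₁
InCID A = Σ IntegralDomain λ R →
  Σ (Maybe (IntegralDomain.Carrier R) → Alg.Carrier A) λ h → IsEnlIso R A h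

Axiomatizes : (CondEq → Set) → (Alg → Set₁) → Set₁
Axiomatizes E K = (A : Alg) → ((∀ e → E e → A ⊨ e) → K A) × (K A → ∀ e → E e → A ⊨ e)

-- Every conditional equation holds in the one-element algebra, so every
-- class axiomatized by conditional equations contains it.  In an algebra
-- isomorphic to Enl_⊥(R_÷), however, 0 and ⊥ are distinct elements.

module Submission where

open import Defs
open import Data.Product using (Σ; _,_; proj₁)
open import Data.Unit using (⊤; tt)
open import Relation.Nullary using (¬_)
open import Relation.Binary.PropositionalEquality using (_≢_; refl; trans; sym)

trivialAlg : Alg
trivialAlg = record
  { Carrier = ⊤ ; zero = tt ; one = tt ; bot = tt
  ; neg = λ _ → tt ; add = λ _ _ → tt ; mul = λ _ _ → tt ; div = λ _ _ → tt
  }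

trivialAlg-⊨ : ∀ e → trivialAlg ⊨ e
trivialAlg-⊨ (ps ⇒ c) ρ _ = refl

axiomatized⇒trivialAlg : ∀ {E K} → Axiomatizes E K → K trivialAlg
axiomatized⇒trivialAlg ax = proj₁ (ax trivialAlg) (λ e _ → trivialAlg-⊨ e)

InCID⇒zero≢bot : ∀ {A} → InCID A → Alg.zero A ≢ Alg.bot A
InCID⇒zero≢bot (R , h , iso) 0≡⊥ with proj₁ bijective (trans hom-0 (trans 0≡⊥ (sym hom-⊥)))
  where open IsEnlIso iso
... | ()

mainTheorem20 : ¬ (Σ (CondEq → Set) λ E → Axiomatizes E InCID)
mainTheorem20 (E , ax) = InCID⇒zero≢bot (axiomatized⇒trivialAlg ax) refl
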